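{- Let $\Phi:(S,\cdot)\to(T,\cdot)$ be a semigroup homomorphism such that $\Phi(S)$ is piecewise syndetic in $T$. If $A\subseteq S$ is piecewise syndetic in $S$, then $\Phi(A)$ is piecewise syndetic in $T$.
   Context: For a semigroup $(X,\cdot)$, $B\subseteq X$ and $x\in X$, let $x^{ -1}B=\{y\in X: x\cdot y\in B\}$; $\mathcal P_f(X)$ denotes the set of finite nonempty subsets of $X$. A set $B\subseteq X$ is piecewise syndetic in $X$ if there exists $G\in\mathcal P_f(X)$ such that for every $F\in\mathcal P_f(X)$ there exists $x\in X$ with $F\cdot x\subseteq\bigcup_{t\in G}t^{ -1}B$. -}

module Defs where

open import Level using (Level; _⊔_; suc)
open import Algebra.Bundles using (Semigroup)
open import Algebra.Morphism.Structures using (IsMagmaHomomorphism)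
open import Data.List.NonEmpty using (List⁺; toList)
open import Data.List.Membership.Propositional using (_∈_)
open import Data.Product using (Σ; ∃; _×_)
open import Data.Unit using (⊤)
open import Level using (Lift)

Subset : ∀ {a} → Set a → Set (suc a)
Subset {a} X = X → Set a

module _ {a ℓ : Level} (X : Semigroup a ℓ) where
  open Semigroup X

  _⁻¹·_ : Carrier → Subset Carrier → Subset Carrier
  (x ⁻¹· B) y = B (x ∙ y)

  -- B is piecewise syndetic: ∃ G ∈ P_f(X) ∀ F ∈ P_f(X) ∃ x, F·x ⊆ ⋃_{t∈G} t⁻¹B
  -- (finite nonempty subsets are represented by nonempty lists)
  PiecewiseSyndetic : Subset Carrier → Set a
  PiecewiseSyndetic B =
    Σ (List⁺ Carrier) λ G → (F : List⁺ Carrier) → ∃ λ x →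
      ∀ f → f ∈ toList F → ∃ λ t → t ∈ toList G × (t ⁻¹· B) (f ∙ x)

-- image of a subset under a map, taken up to the setoid equality of the codomain
image : ∀ {a} {A : Set a} (T : Semigroup a a) →
        (A → Semigroup.Carrier T) → Subset A → Subset (Semigroup.Carrier T)
image T Φ A y = ∃ λ x → A x × Semigroup._≈_ T (Φ x) y

whole : ∀ {a} (A : Set a) → Subset A
whole A _ = Lift _ ⊤

module Submission where

-- Let G_Φ witness that Φ(S) is piecewise syndetic
-- in T and G_A witness that A is piecewise syndetic in S.  Given a finite
-- F ⊆ T, choose y with F·y ⊆ ⋃_{t∈G_Φ} t⁻¹Φ(S): every f ∈ F has some t_f ∈ G_Φ
-- and a_f ∈ S with t_f·f·y = Φ(a_f).  Applying the hypothesis on A to the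
-- finite set {a_f : f ∈ F} gives x ∈ S and s_f ∈ G_A with s_f·a_f·x ∈ A, so
--   (Φ(s_f)·t_f)·f·(y·Φ(x)) = Φ(s_f)·Φ(a_f)·Φ(x) = Φ(s_f·a_f·x) ∈ Φ(A).
-- Hence G = {Φ(s)·t : s ∈ G_A, t ∈ G_Φ} and the shift y·Φ(x) witness that
-- Φ(A) is piecewise syndetic.

open import Defs
open import Algebra.Bundles using (Semigroup)
open import Algebra.Morphism.Structures using (IsMagmaHomomorphism)
open import Data.List using (List; _∷_; cartesianProductWith)
open import Data.List.NonEmpty using (List⁺; _∷_; toList; head)
open import Data.List.Membership.Propositional using (_∈_; mapWith∈)
open import Data.List.Membership.Propositional.Properties using (∈-cartesianProductWith⁺)
open import Data.List.Relation.Unary.Any using (there)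
open import Data.List.Relation.Unary.Any.Properties using (mapWith∈⁺)
open import Data.Product using (∃; _×_; _,_; proj₁; proj₂)
open import Relation.Binary.PropositionalEquality using (refl)
import Relation.Binary.Reasoning.Setoid as SetoidReasoning

-- Finite sets are nonempty lists; the "product set" {k x y : x ∈ xs, y ∈ ys}
-- of two of them is again nonempty (its first entry is repeated, harmlessly).
productWith⁺ : ∀ {a b c} {X : Set a} {Y : Set b} {Z : Set c} →
               (X → Y → Z) → List⁺ X → List⁺ Y → List⁺ Z
productWith⁺ k xs ys = k (head xs) (head ys) ∷ cartesianProductWith k (toList xs) (toList ys)

∈-productWith⁺ : ∀ {a b c} {X : Set a} {Y : Set b} {Z : Set c} (k : X → Y → Z) {xs ys x y} →
                 x ∈ toList xs → y ∈ toList ys → k x y ∈ toList (productWith⁺ k xs ys)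
∈-productWith⁺ k x∈xs y∈ys = there (∈-cartesianProductWith⁺ k x∈xs y∈ys)

∈-mapWith∈ : ∀ {a b} {X : Set a} {Y : Set b} (xs : List X) (h : ∀ {x} → x ∈ xs → Y)
             {x} (x∈xs : x ∈ xs) → h x∈xs ∈ mapWith∈ xs h
∈-mapWith∈ xs h x∈xs = mapWith∈⁺ h (_ , x∈xs , refl)

module _ {a ℓ} (X : Semigroup a ℓ) where
  open Semigroup X

  Covers : List Carrier → Subset Carrier → List Carrier → Carrier → Set a
  Covers G B F x = ∀ f → f ∈ F → ∃ λ t → t ∈ G × (_⁻¹·_ X t B) (f ∙ x)

  -- The witness set of a piecewise syndetic set covers every finite list,
  -- not only nonempty ones: pad the list with an arbitrary element.
  covers-any-list : ∀ {B} (ps : PiecewiseSyndetic X B) (F : List Carrier) →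
                    ∃ (Covers (toList (proj₁ ps)) B F)
  covers-any-list (g ∷ _ , cover) F with cover (g ∷ F)
  ... | x , covered = x , λ f f∈F → covered f (there f∈F)

module _ {a} (S T : Semigroup a a) {Φ : Semigroup.Carrier S → Semigroup.Carrier T}
         (hom : IsMagmaHomomorphism (Semigroup.rawMagma S) (Semigroup.rawMagma T) Φ)
         where
  module S = Semigroup S
  open Semigroup T
  open IsMagmaHomomorphism hom using (homo)

  shift-into-image : ∀ s t f y x a → Φ a ≈ t ∙ (f ∙ y) →
                     Φ (s S.∙ (a S.∙ x)) ≈ (Φ s ∙ t) ∙ (f ∙ (y ∙ Φ x))
  shift-into-image s t f y x a Φa≈t·f·y = begin
    Φ (s S.∙ (a S.∙ x))          ≈⟨ homo s (a S.∙ x) ⟩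
    Φ s ∙ Φ (a S.∙ x)            ≈⟨ ∙-congˡ (homo a x) ⟩
    Φ s ∙ (Φ a ∙ Φ x)            ≈⟨ ∙-congˡ (∙-congʳ Φa≈t·f·y) ⟩
    Φ s ∙ ((t ∙ (f ∙ y)) ∙ Φ x)  ≈⟨ ∙-congˡ (assoc t (f ∙ y) (Φ x)) ⟩
    Φ s ∙ (t ∙ ((f ∙ y) ∙ Φ x))  ≈⟨ ∙-congˡ (∙-congˡ (assoc f y (Φ x))) ⟩
    Φ s ∙ (t ∙ (f ∙ (y ∙ Φ x)))  ≈⟨ sym (assoc (Φ s) t (f ∙ (y ∙ Φ x))) ⟩
    (Φ s ∙ t) ∙ (f ∙ (y ∙ Φ x))  ∎
    where open SetoidReasoning setoid

  preimage : ∀ {GΦ F y} → Covers T GΦ (image T Φ (whole S.Carrier)) F y →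
             ∀ {f} → f ∈ F → S.Carrier
  preimage covered f∈F = proj₁ (proj₂ (proj₂ (covered _ f∈F)))

  combine-covers : ∀ A {GA GΦ} G {F y x} →
    (∀ {s t} → s ∈ GA → t ∈ GΦ → Φ s ∙ t ∈ G) →
    (coveredΦ : Covers T GΦ (image T Φ (whole S.Carrier)) F y) →
    Covers S GA A (mapWith∈ F (preimage coveredΦ)) x →
    Covers T G (image T Φ A) F (y ∙ Φ x)
  combine-covers A G {F} {y} {x} products∈G coveredΦ coveredA f f∈F
    with coveredΦ f f∈F | coveredA _ (∈-mapWith∈ F (preimage coveredΦ) f∈F)
  ... | t , t∈GΦ , (a , _ , Φa≈t·f·y) | s , s∈GA , A[s·a·x] =
    Φ s ∙ t , products∈G s∈GA t∈GΦ ,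
    (s S.∙ (a S.∙ x) , A[s·a·x] , shift-into-image s t f y x a Φa≈t·f·y)

theorem3p1 : ∀ {a} (S T : Semigroup a a) (Φ : Semigroup.Carrier S → Semigroup.Carrier T) →
    IsMagmaHomomorphism (Semigroup.rawMagma S) (Semigroup.rawMagma T) Φ →
    PiecewiseSyndetic T (image T Φ (whole (Semigroup.Carrier S))) →
    (A : Subset (Semigroup.Carrier S)) →
    PiecewiseSyndetic S A →
    PiecewiseSyndetic T (image T Φ A)
theorem3p1 S T Φ hom (GΦ , coverΦ) A psA@(GA , _) = G , cover
  where
  open Semigroup T using (_∙_)
  G : List⁺ (Semigroup.Carrier T)
  G = productWith⁺ (λ s t → Φ s ∙ t) GA GΦ
  cover : ∀ F → ∃ (Covers T (toList G) (image T Φ A) (toList F))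
  cover F with coverΦ F
  ... | y , coveredΦ
    with covers-any-list S {B = A} psA (mapWith∈ (toList F) (preimage S T hom coveredΦ))
  ... | x , coveredA = y ∙ Φ x ,
    combine-covers S T hom A (toList G) (∈-productWith⁺ _) coveredΦ coveredA
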